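{- If rooted-signed-binary trees $T$ and $T'$ are related by allowed tree rotations, then they produce the same cycle under the insertion construction.
   Context: A rooted-signed-binary tree is a finite rooted binary tree (each node has at most one left and at most one right child) in which every non-root node has a sign $+$ or $-$; the root is unsigned. Rotations: if $c$ is the left child of $v$, a right rotation at $v$ puts $c$ in $v$'s place, makes $v$ the right child of $c$, and makes the former right subtree of $c$ the left subtree of $v$; the left rotation is its inverse. A rotation is allowed if either $v$ is not the root and $v$ and the child $c$ rotating into its place have the same sign, or $v$ is the root, in which case $c$ becomes the new unsigned root and $v$ gets the sign $c$ had. A tree with $m$ nodes has $m+1$ empty child slots, ordered left to right in symmetric (in-order) order. A non-root leaf $v$ of $T$ is in relative position $i$ if it occupies the $i$-th empty slot of $T-\{v\}$ ($T$ with $v$ deleted). Construction: let $\xi_m(k)=k$ for $k<m$ and $\xi_m(k)=k+1$ for $k\ge m$. For a permutation $s_1\cdots s_n$ and $1\le i\le n$, positive insertion at $i$ gives $\xi_{i+1}(s_1)\cdots \xi_{i+1}(s_{i-1})\,(i{+}1)\,\xi_{i+1}(s_{i})\cdots \xi_{i+1}(s_{n})$, negative insertion at $i$ gives $\xi_{i}(s_1)\cdots \xi_{i}(s_{i})\,(i)\,\xi_{i}(s_{i+1})\cdots \xi_{i}(s_{n})$. Starting with $21$ for the root alone, process the non-root nodes in an order where each node follows its non-root parent; when $v$ is processed, with relative position $i$ in the tree formed by the root, the nodes processed so far and $v$, apply the positive or negative insertion at $i$ according to the sign of $v$. The resulting permutation is the cycle produced by the tree (it is independent of the processing order). -}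

module Defs where

open import Data.Nat using (ℕ; zero; suc; _+_; _∸_; _<ᵇ_)
open import Data.Bool using (Bool; true; false; not; if_then_else_; _∧_; _∨_)
open import Data.List using (List; []; _∷_; _++_; [_]; map; take; drop; length; filterᵇ; concatMap)
open import Data.Bool.ListAction using (any)
open import Data.Product using (_×_; _,_)
open import Relation.Binary.Construct.Closure.ReflexiveTransitive using (Star)

data Sign : Set where
  plus minus : Sign

data STree : Set where
  leaf : STree
  node : Sign → STree → STree → STree

record RTree : Set where
  constructor root
  field
    left  : STree
    right : STree

data RotS : STree → STree → Set where
  rotR : ∀ s A B C → RotS (node s (node s A B) C) (node s A (node s B C))
  rotL : ∀ s A B C → RotS (node s A (node s B C)) (node s (node s A B) C)
  inL  : ∀ {A A'} s B → RotS A A' → RotS (node s A B) (node s A' B)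
  inR  : ∀ {B B'} s A → RotS B B' → RotS (node s A B) (node s A B')

-- Rotations of a rooted tree: at the root (the child c becomes the new
-- unsigned root and the old root gets c's sign), or inside a subtree.
data Rot : RTree → RTree → Set where
  rootR  : ∀ s A B C → Rot (root (node s A B) C) (root A (node s B C))
  rootL  : ∀ s A B C → Rot (root A (node s B C)) (root (node s A B) C)
  underL : ∀ {A A'} B → RotS A A' → Rot (root A B) (root A' B)
  underR : ∀ {B B'} A → RotS B B' → Rot (root A B) (root A B')

RotRelated : RTree → RTree → Set
RotRelated = Star Rot

ξ : ℕ → ℕ → ℕ
ξ m k = if k <ᵇ m then k else suc k

posIns : ℕ → List ℕ → List ℕ
posIns i s = map (ξ (suc i)) (take (i ∸ 1) s) ++ suc i ∷ map (ξ (suc i)) (drop (i ∸ 1) s)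

negIns : ℕ → List ℕ → List ℕ
negIns i s = map (ξ i) (take i s) ++ i ∷ map (ξ i) (drop i s)

insert : Sign → ℕ → List ℕ → List ℕ
insert plus  = posIns
insert minus = negIns

-- Positions of nodes / empty slots as paths from the root.

data Dir : Set where
  L R : Dir

Path : Set
Path = List Dir

_==D_ : Dir → Dir → Bool
L ==D L = true
R ==D R = true
_ ==D _ = false

_==P_ : Path → Path → Bool
[] ==P [] = true
(d ∷ p) ==P (e ∷ q) = (d ==D e) ∧ (p ==P q)
_ ==P _ = false

_∈ᵇ_ : Path → List Path → Bool
p ∈ᵇ S = any (p ==P_) S

-- In-order (symmetric order) key of a position: L ↦ 0, R ↦ 2, end ↦ 1,
-- compared lexicographically.
key : Path → List ℕ
key p = map (λ { L → 0 ; R → 2 }) p ++ [ 1 ]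

lexLt : List ℕ → List ℕ → Bool
lexLt [] [] = false
lexLt [] (_ ∷ _) = true
lexLt (_ ∷ _) [] = false
lexLt (a ∷ as) (b ∷ bs) = (a <ᵇ b) ∨ (if b <ᵇ a then false else lexLt as bs)

_before_ : Path → Path → Bool
p before q = lexLt (key p) (key q)

-- Empty child slots of the tree whose node set (root = []) is S.
slots : List Path → List Path
slots S = concatMap (λ u → filterᵇ (λ c → not (c ∈ᵇ S)) ((u ++ [ L ]) ∷ (u ++ [ R ]) ∷ [])) S

-- Relative position of the leaf v added to the tree with node set S
-- (= T - {v}): the index (1-based) of the slot of S occupied by v.
relPos : List Path → Path → ℕ
relPos S v = suc (length (filterᵇ (λ c → c before v) (slots S)))

pre : Path → STree → List (Path × Sign)
pre p leaf = []
pre p (node s l r) = (p , s) ∷ (pre (p ++ [ L ]) l ++ pre (p ++ [ R ]) r)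

preorder : RTree → List (Path × Sign)
preorder (root l r) = pre [ L ] l ++ pre [ R ] r

-- Process nodes: S = node set of root + processed nodes.
process : List Path → List (Path × Sign) → List ℕ → List ℕ
process S [] perm = perm
process S ((v , s) ∷ rest) perm = process (S ++ [ v ]) rest (insert s (relPos S v) perm)

-- The cycle produced by a tree (one-line notation), starting from 21.
cycleOf : RTree → List ℕ
cycleOf T = process ([] ∷ []) (preorder T) (2 ∷ 1 ∷ [])

-- Read a sequence σ : ℕ → ℕ at 1, 2, … as a permutation in one-line notation.  Both
-- insertions then become "insert a value at a position", and two such insertions commute
-- up to shifting the later position and value (insertAt-comm).  The cycle of a tree is
-- therefore a composite of insertions indexed by the subtrees: inserting a subtree t whose
-- root has relative position i is the map expand i t.  A rotation merely moves the second
-- of two equal-sign insertions at position i past the insertions of a subtree A, to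
-- position i + size A + 1, and these commutations absorb that, so expand is invariant.
--
-- What links this to the construction is that relative positions are computable locally:
-- in symmetric order the empty slots and the nodes of a tree alternate, so the slots
-- before a slot v are as many as the nodes before v.  Hence, processing in preorder, the
-- left child of a node at relative position i is again at i and the right child at
-- i + size l + 1.
module Submission where

open import Data.Bool using (Bool; true; false; not; if_then_else_; _∧_; _∨_)
open import Data.Bool.Properties using (∨-assoc; ∨-identityʳ; ∨-zeroʳ; ∨-conicalˡ)
open import Data.Empty using (⊥-elim)
open import Data.List using (List; []; _∷_; _++_; [_]; map; take; drop; iterate; length; filterᵇ; concatMap)
open import Data.List.Properties
  using (++-assoc; ++-identityʳ; ++-cancelˡ; ∷ʳ-injectiveˡ; ∷ʳ-injectiveʳ; concatMap-++; map-++; length-++; map-cong)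
open import Data.List.Relation.Unary.All as All using (All; []; _∷_)
import Data.List.Relation.Unary.All.Properties as All
open import Data.Nat using (ℕ; zero; suc; _+_; _*_; _∸_; _<ᵇ_; _≡ᵇ_; _≤_; _<_; _<?_; z≤n; s≤s; pred)
open import Data.Nat.Properties
open import Data.Product using (Σ; _,_; proj₁)
open import Function using (_∘_)
open import Relation.Binary using (tri<; tri≈; tri>)
open import Relation.Binary.Construct.Closure.ReflexiveTransitive using (ε; _◅_)
open import Relation.Binary.PropositionalEquality hiding ([_])
open import Relation.Nullary using (¬_; yes; no)

open import Defs

open import Algebra.Properties.CommutativeSemigroup +-commutativeSemigroup using () renaming (interchange to +-interchange)

-- Insertions as maps on sequences

<ᵇ-true : ∀ {m n} → m < n → (m <ᵇ n) ≡ true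
<ᵇ-true {zero}  {suc n} _       = refl
<ᵇ-true {suc m} {suc n} (s≤s p) = <ᵇ-true p

<ᵇ-false : ∀ {m n} → n ≤ m → (m <ᵇ n) ≡ false
<ᵇ-false {m}     {zero}  _       = refl
<ᵇ-false {suc m} {suc n} (s≤s p) = <ᵇ-false p

≡ᵇ-refl : ∀ n → (n ≡ᵇ n) ≡ true
≡ᵇ-refl zero    = refl
≡ᵇ-refl (suc n) = ≡ᵇ-refl n

≡ᵇ-false : ∀ {m n} → m < n → (n ≡ᵇ m) ≡ false
≡ᵇ-false {zero}  {suc n} _       = refl
≡ᵇ-false {suc m} {suc n} (s≤s p) = ≡ᵇ-false p

ξ-< : ∀ {m k} → k < m → ξ m k ≡ k
ξ-< k<m rewrite <ᵇ-true k<m = refl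

ξ-≥ : ∀ {m k} → m ≤ k → ξ m k ≡ suc k
ξ-≥ m≤k rewrite <ᵇ-false m≤k = refl

ξ-comm : ∀ {m m'} → m ≤ m' → ∀ y → ξ (suc m') (ξ m y) ≡ ξ m (ξ m' y)
ξ-comm {m} {m'} m≤m' y with y <? m | y <? m'
... | yes y<m | _ rewrite ξ-< (<-≤-trans y<m m≤m') | ξ-< y<m =
  ξ-< (m<n⇒m<1+n (<-≤-trans y<m m≤m'))
... | no y≮m | yes y<m' rewrite ξ-< y<m' | ξ-≥ (≮⇒≥ y≮m) = ξ-< (s≤s y<m')
... | no y≮m | no y≮m' rewrite ξ-≥ (≮⇒≥ y≮m') | ξ-≥ (≮⇒≥ y≮m) =
  trans (ξ-≥ (s≤s (≮⇒≥ y≮m'))) (sym (ξ-≥ (m≤n⇒m≤1+n (≮⇒≥ y≮m))))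

insertAt : ℕ → ℕ → (ℕ → ℕ) → ℕ → ℕ
insertAt a m σ x = if x <ᵇ a then ξ m (σ x) else (if x ≡ᵇ a then m else ξ m (σ (pred x)))

insertAt-< : ∀ {a m σ x} → x < a → insertAt a m σ x ≡ ξ m (σ x)
insertAt-< x<a rewrite <ᵇ-true x<a = refl

insertAt-≡ : ∀ {a m σ} → insertAt a m σ a ≡ m
insertAt-≡ {a} rewrite <ᵇ-false (≤-refl {a}) | ≡ᵇ-refl a = refl

insertAt-> : ∀ {a m σ x} → a < x → insertAt a m σ x ≡ ξ m (σ (pred x))
insertAt-> a<x rewrite <ᵇ-false (<⇒≤ a<x) | ≡ᵇ-false a<x = refl

insertAt-cong : ∀ a m {σ τ} → σ ≗ τ → insertAt a m σ ≗ insertAt a m τ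
insertAt-cong a m σ≗τ x rewrite σ≗τ x | σ≗τ (pred x) = refl

pred-< : ∀ {a x b} → a < x → x ≤ b → pred x < b
pred-< {x = suc x} _ x≤b = x≤b

insertAt-comm : ∀ {a a' m m'} → a ≤ a' → m ≤ m' → ∀ σ →
  insertAt (suc a') (suc m') (insertAt a m σ) ≗ insertAt a m (insertAt a' m' σ)
insertAt-comm {a} {a'} {m} {m'} a≤a' m≤m' σ x with <-cmp x a
... | tri< x<a _ _
  rewrite insertAt-< {suc a'} {suc m'} {insertAt a m σ} (m<n⇒m<1+n (<-≤-trans x<a a≤a'))
        | insertAt-< {a} {m} {σ} x<a | insertAt-< {a} {m} {insertAt a' m' σ} x<a
        | insertAt-< {a'} {m'} {σ} (<-≤-trans x<a a≤a')
  = ξ-comm m≤m' (σ x)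
... | tri≈ _ refl _
  rewrite insertAt-< {suc a'} {suc m'} {insertAt x m σ} (s≤s a≤a')
        | insertAt-≡ {x} {m} {σ} | insertAt-≡ {x} {m} {insertAt a' m' σ}
  = ξ-< (s≤s m≤m')
... | tri> _ _ a<x with <-cmp x (suc a')
...   | tri< x<1+a' _ _
  rewrite insertAt-< {suc a'} {suc m'} {insertAt a m σ} x<1+a'
        | insertAt-> {a} {m} {σ} a<x | insertAt-> {a} {m} {insertAt a' m' σ} a<x
        | insertAt-< {a'} {m'} {σ} (pred-< a<x (≤-pred x<1+a'))
  = ξ-comm m≤m' (σ (pred x))
...   | tri≈ _ refl _
  rewrite insertAt-≡ {suc a'} {suc m'} {insertAt a m σ}
        | insertAt-> {a} {m} {insertAt a' m' σ} a<x | insertAt-≡ {a'} {m'} {σ}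
  = sym (ξ-≥ m≤m')
...   | tri> _ _ 1+a'<x
  rewrite insertAt-> {suc a'} {suc m'} {insertAt a m σ} 1+a'<x
        | insertAt-> {a} {m} {σ} {pred x} (≤-trans (s≤s a≤a') (pred-mono-≤ 1+a'<x))
        | insertAt-> {a} {m} {insertAt a' m' σ} a<x
        | insertAt-> {a'} {m'} {σ} {pred x} (pred-mono-≤ 1+a'<x)
  = ξ-comm m≤m' (σ (pred (pred x)))

position value : Sign → ℕ → ℕ
position plus  i = i
position minus i = suc i
value plus  i = suc i
value minus i = i

signedInsert : Sign → ℕ → (ℕ → ℕ) → ℕ → ℕ
signedInsert s i = insertAt (position s i) (value s i)

position-mono : ∀ s s' {i k} → i < k → position s i ≤ position s' k
position-mono plus  plus  i<k = <⇒≤ i<k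
position-mono plus  minus i<k = m≤n⇒m≤1+n (<⇒≤ i<k)
position-mono minus plus  i<k = i<k
position-mono minus minus i<k = s≤s (<⇒≤ i<k)

value-mono : ∀ s s' {i k} → i < k → value s i ≤ value s' k
value-mono plus  plus  i<k = s≤s (<⇒≤ i<k)
value-mono plus  minus i<k = i<k
value-mono minus plus  i<k = m≤n⇒m≤1+n (<⇒≤ i<k)
value-mono minus minus i<k = <⇒≤ i<k

signedInsert-comm : ∀ s s' {i k} → i < k → ∀ σ →
  signedInsert s' (suc k) (signedInsert s i σ) ≗ signedInsert s i (signedInsert s' k σ)
signedInsert-comm s plus  i<k = insertAt-comm (position-mono s plus i<k) (value-mono s plus i<k)
signedInsert-comm s minus i<k = insertAt-comm (position-mono s minus i<k) (value-mono s minus i<k)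

signedInsert-twice : ∀ s i σ →
  signedInsert s (suc i) (signedInsert s i σ) ≗ signedInsert s i (signedInsert s i σ)
signedInsert-twice plus  i = insertAt-comm ≤-refl ≤-refl
signedInsert-twice minus i = insertAt-comm ≤-refl ≤-refl

map-insertAt-above : ∀ a m σ n b → a < suc b →
  map (insertAt a m σ) (iterate suc (suc b) n) ≡ map (ξ m) (map σ (iterate suc b n))
map-insertAt-above a m σ zero    b _   = refl
map-insertAt-above a m σ (suc n) b a≤b rewrite insertAt-> {a} {m} {σ} a≤b =
  cong (ξ m (σ b) ∷_) (map-insertAt-above a m σ n (suc b) (m<n⇒m<1+n a≤b))

splitInsert-map : ∀ k n a m σ → let xs = map σ (iterate suc a (k + n)) in
  map (ξ m) (take k xs) ++ m ∷ map (ξ m) (drop k xs) ≡ map (insertAt (a + k) m σ) (iterate suc a (suc (k + n)))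
splitInsert-map zero n a m σ rewrite +-identityʳ a | insertAt-≡ {a} {m} {σ} =
  cong (m ∷_) (sym (map-insertAt-above a m σ n a ≤-refl))
splitInsert-map (suc k) n a m σ rewrite insertAt-< {a + suc k} {m} {σ} {a} (m<m+n a (s≤s z≤n)) =
  cong (ξ m (σ a) ∷_) (trans (splitInsert-map k n (suc a) m σ)
                             (cong (λ b → map (insertAt b m σ) (iterate suc (suc a) (suc (k + n)))) (sym (+-suc a k))))

insert≡signedInsert : ∀ s i σ N → 1 ≤ i → i ≤ N →
  insert s i (map σ (iterate suc 1 N)) ≡ map (signedInsert s i σ) (iterate suc 1 (suc N))
insert≡signedInsert plus zero σ N () _
insert≡signedInsert plus (suc j) σ N _ i≤N with N ∸ j | m+[n∸m]≡n (<⇒≤ i≤N)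
... | n | refl = splitInsert-map j n 1 (suc (suc j)) σ
insert≡signedInsert minus i σ N _ i≤N with N ∸ i | m+[n∸m]≡n i≤N
... | n | refl = splitInsert-map i n 1 i σ

-- Subtree insertions and rotations

size : STree → ℕ
size leaf         = 0
size (node _ l r) = suc (size l + size r)

-- The effect of inserting the nodes of t in preorder when its root has relative position i.
expand : ℕ → STree → (ℕ → ℕ) → ℕ → ℕ
expand i leaf         σ = σ
expand i (node s l r) σ = expand (suc (i + size l)) r (expand i l (signedInsert s i σ))

expand-cong : ∀ i t {σ τ} → σ ≗ τ → expand i t σ ≗ expand i t τ
expand-cong i leaf         σ≗τ = σ≗τ
expand-cong i (node s l r) σ≗τ =
  expand-cong _ r (expand-cong i l (insertAt-cong (position s i) (value s i) σ≗τ))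

signedInsert-expand-comm : ∀ s' A {i k} → i < k → ∀ σ →
  signedInsert s' (k + size A) (expand i A σ) ≗ expand i A (signedInsert s' k σ)
signedInsert-expand-comm s' leaf {k = k} _ σ x rewrite +-identityʳ k = refl
signedInsert-expand-comm s' (node s l r) {i} {k} i<k σ x =
  begin
    signedInsert s' (k + suc (size l + size r)) (expand j r (expand i l (signedInsert s i σ))) x
  ≡⟨ cong (λ n → signedInsert s' n (expand j r (expand i l (signedInsert s i σ))) x) k+size≡ ⟩
    signedInsert s' (suc k + size l + size r) (expand j r (expand i l (signedInsert s i σ))) x
  ≡⟨ signedInsert-expand-comm s' r (s≤s (+-monoˡ-< (size l) i<k)) _ x ⟩
    expand j r (signedInsert s' (suc k + size l) (expand i l (signedInsert s i σ))) x
  ≡⟨ expand-cong j r (signedInsert-expand-comm s' l (m<n⇒m<1+n i<k) _) x ⟩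
    expand j r (expand i l (signedInsert s' (suc k) (signedInsert s i σ))) x
  ≡⟨ expand-cong j r (expand-cong i l (signedInsert-comm s s' i<k σ)) x ⟩
    expand j r (expand i l (signedInsert s i (signedInsert s' k σ))) x
  ∎
  where
  open ≡-Reasoning
  j = suc (i + size l)
  k+size≡ : k + suc (size l + size r) ≡ suc k + size l + size r
  k+size≡ = trans (+-suc k _) (cong suc (sym (+-assoc k (size l) (size r))))

size-rotS : ∀ {t t'} → RotS t t' → size t ≡ size t'
size-rotS (rotR _ A B C) = cong suc (trans (cong suc (+-assoc (size A) (size B) (size C)))
                                           (sym (+-suc (size A) _)))
size-rotS (rotL s A B C) = sym (size-rotS (rotR s A B C))
size-rotS (inL _ B r)    = cong (λ n → suc (n + size B)) (size-rotS r)
size-rotS (inR _ A r)    = cong (λ n → suc (size A + n)) (size-rotS r)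

-- The left tree inserts its two top nodes both at i, the right tree at i and, after A,
-- at i + size A + 1.
expand-rotR : ∀ s A B C i σ → expand i (node s (node s A B) C) σ ≗ expand i (node s A (node s B C)) σ
expand-rotR s A B C i σ x =
  begin
    expand (suc (i + suc (size A + size B))) C (expand j B (expand i A τ)) x
  ≡⟨ cong (λ n → expand n C (expand j B (expand i A τ)) x) (cong suc (+-suc i _)) ⟩
    expand (suc (suc (i + (size A + size B)))) C (expand j B (expand i A τ)) x
  ≡⟨ cong (λ n → expand (suc (suc n)) C (expand j B (expand i A τ)) x) (sym (+-assoc i (size A) (size B))) ⟩
    expand (suc (j + size B)) C (expand j B (expand i A τ)) x
  ≡⟨ expand-cong _ C (expand-cong j B (expand-cong i A (λ y → sym (signedInsert-twice s i σ y)))) x ⟩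
    expand (suc (j + size B)) C (expand j B (expand i A (signedInsert s (suc i) (signedInsert s i σ)))) x
  ≡⟨ expand-cong _ C (expand-cong j B (λ y → sym (signedInsert-expand-comm s A ≤-refl _ y))) x ⟩
    expand (suc (j + size B)) C (expand j B (signedInsert s j (expand i A (signedInsert s i σ)))) x
  ∎
  where
  open ≡-Reasoning
  j = suc (i + size A)
  τ = signedInsert s i (signedInsert s i σ)

expand-rotS : ∀ {t t'} → RotS t t' → ∀ i σ → expand i t σ ≗ expand i t' σ
expand-rotS (rotR s A B C) i σ = expand-rotR s A B C i σ
expand-rotS (rotL s A B C) i σ x = sym (expand-rotR s A B C i σ x)
expand-rotS (inL {A} {A'} s B r) i σ x =
  trans (expand-cong _ B (expand-rotS r i (signedInsert s i σ)) x)
        (cong (λ n → expand (suc (i + n)) B (expand i A' (signedInsert s i σ)) x) (size-rotS r))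
expand-rotS (inR s A r) i σ = expand-rotS r _ _

σ₀ : ℕ → ℕ
σ₀ 1 = 2
σ₀ 2 = 1
σ₀ x = x

signedInsert-σ₀ : ∀ s → signedInsert s 2 σ₀ ≗ signedInsert s 1 σ₀
signedInsert-σ₀ plus  0 = refl
signedInsert-σ₀ plus  1 = refl
signedInsert-σ₀ plus  2 = refl
signedInsert-σ₀ plus  3 = refl
signedInsert-σ₀ plus  (suc (suc (suc (suc _)))) = refl
signedInsert-σ₀ minus 0 = refl
signedInsert-σ₀ minus 1 = refl
signedInsert-σ₀ minus 2 = refl
signedInsert-σ₀ minus 3 = refl
signedInsert-σ₀ minus (suc (suc (suc (suc _)))) = refl

rsize : RTree → ℕ
rsize (root A C) = size A + size C

cycleFun : RTree → ℕ → ℕ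
cycleFun (root A C) = expand (suc (suc (size A))) C (expand 1 A σ₀)

rsize-rot : ∀ {T T'} → Rot T T' → rsize T ≡ rsize T'
rsize-rot (rootR _ A B C) = trans (cong suc (+-assoc (size A) (size B) (size C))) (sym (+-suc (size A) _))
rsize-rot (rootL s A B C) = sym (rsize-rot (rootR s A B C))
rsize-rot (underL B r)    = cong (_+ size B) (size-rotS r)
rsize-rot (underR A r)    = cong (size A +_) (size-rotS r)

cycleFun-rot : ∀ {T T'} → Rot T T' → cycleFun T ≗ cycleFun T'
cycleFun-rot (rootR s A B C) = expand-cong _ C (expand-cong _ B (λ y →
  trans (expand-cong 1 A (λ z → sym (signedInsert-σ₀ s z)) y)
        (sym (signedInsert-expand-comm s A (s≤s (s≤s z≤n)) σ₀ y))))
cycleFun-rot (rootL s A B C) x = sym (cycleFun-rot (rootR s A B C) x)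
cycleFun-rot (underL {A} {A'} B r) x =
  trans (expand-cong _ B (expand-rotS r 1 σ₀) x)
        (cong (λ n → expand (suc (suc n)) B (expand 1 A' σ₀) x) (size-rotS r))
cycleFun-rot (underR A r) = expand-rotS r _ _

-- Counting, paths and symmetric order

true≢false : true ≢ false
true≢false ()

indicator : Bool → ℕ
indicator true  = 1
indicator false = 0

count : ∀ {A : Set} → (A → Bool) → List A → ℕ
count P []       = 0
count P (x ∷ xs) = indicator (P x) + count P xs

length-filterᵇ : ∀ {A : Set} (P : A → Bool) xs → length (filterᵇ P xs) ≡ count P xs
length-filterᵇ P [] = refl
length-filterᵇ P (x ∷ xs) with P x
... | true  = cong suc (length-filterᵇ P xs)
... | false = length-filterᵇ P xs

count-++ : ∀ {A : Set} (P : A → Bool) xs ys → count P (xs ++ ys) ≡ count P xs + count P ys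
count-++ P []       ys = refl
count-++ P (x ∷ xs) ys rewrite count-++ P xs ys = sym (+-assoc (indicator (P x)) _ _)

count-filterᵇ : ∀ {A : Set} (P Q : A → Bool) xs → count P (filterᵇ Q xs) ≡ count (λ c → Q c ∧ P c) xs
count-filterᵇ P Q [] = refl
count-filterᵇ P Q (x ∷ xs) with Q x
... | true  = cong (indicator (P x) +_) (count-filterᵇ P Q xs)
... | false = count-filterᵇ P Q xs

count-cong : ∀ {A : Set} {P Q : A → Bool} {xs} → All (λ x → P x ≡ Q x) xs → count P xs ≡ count Q xs
count-cong []       = refl
count-cong (e ∷ es) = cong₂ _+_ (cong indicator e) (count-cong es)

count-all : ∀ {A : Set} {P : A → Bool} {xs} → All (λ x → P x ≡ true) xs → count P xs ≡ length xs
count-all []                 = refl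
count-all (e ∷ es) rewrite e = cong suc (count-all es)

count≤length : ∀ {A : Set} (P : A → Bool) xs → count P xs ≤ length xs
count≤length P []       = z≤n
count≤length P (x ∷ xs) = +-mono-≤ (indicator≤1 (P x)) (count≤length P xs)
  where
  indicator≤1 : ∀ b → indicator b ≤ 1
  indicator≤1 true  = ≤-refl
  indicator≤1 false = z≤n

L≢R : L ≢ R
L≢R ()

==P-refl : ∀ p → (p ==P p) ≡ true
==P-refl []      = refl
==P-refl (L ∷ p) = ==P-refl p
==P-refl (R ∷ p) = ==P-refl p

==P⇒≡ : ∀ p q → (p ==P q) ≡ true → p ≡ q
==P⇒≡ []      []      _ = refl
==P⇒≡ (L ∷ p) (L ∷ q) e = cong (L ∷_) (==P⇒≡ p q e)
==P⇒≡ (R ∷ p) (R ∷ q) e = cong (R ∷_) (==P⇒≡ p q e)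
==P⇒≡ []      (_ ∷ _) ()
==P⇒≡ (_ ∷ _) []      ()
==P⇒≡ (L ∷ p) (R ∷ q) ()
==P⇒≡ (R ∷ p) (L ∷ q) ()

==P-false⇒≢ : ∀ {p q} → (p ==P q) ≡ false → p ≢ q
==P-false⇒≢ {p} eq refl = true≢false (trans (sym (==P-refl p)) eq)

≢⇒==P-false : ∀ p q → p ≢ q → (p ==P q) ≡ false
≢⇒==P-false p q p≢q with p ==P q in eq
... | true  = ⊥-elim (p≢q (==P⇒≡ p q eq))
... | false = refl

∷ʳ-==P-false : ∀ u p e d → (u ==P p) ≡ false → ((u ++ [ e ]) ==P (p ++ [ d ])) ≡ false
∷ʳ-==P-false u p e d u≠p = ≢⇒==P-false _ _ (==P-false⇒≢ u≠p ∘ ∷ʳ-injectiveˡ u p)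

==P-sym : ∀ p q → (p ==P q) ≡ (q ==P p)
==P-sym []      []      = refl
==P-sym []      (_ ∷ _) = refl
==P-sym (_ ∷ _) []      = refl
==P-sym (L ∷ p) (L ∷ q) = ==P-sym p q
==P-sym (R ∷ p) (R ∷ q) = ==P-sym p q
==P-sym (L ∷ p) (R ∷ q) = refl
==P-sym (R ∷ p) (L ∷ q) = refl

∈ᵇ-++ : ∀ p xs ys → (p ∈ᵇ (xs ++ ys)) ≡ ((p ∈ᵇ xs) ∨ (p ∈ᵇ ys))
∈ᵇ-++ p []       ys = refl
∈ᵇ-++ p (x ∷ xs) ys rewrite ∈ᵇ-++ p xs ys = sym (∨-assoc (p ==P x) _ _)

∈ᵇ-∷ʳ : ∀ p xs y → (p ∈ᵇ (xs ++ [ y ])) ≡ ((p ∈ᵇ xs) ∨ (p ==P y))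
∈ᵇ-∷ʳ p xs y rewrite ∈ᵇ-++ p xs [ y ] | ∨-identityʳ (p ==P y) = refl

∈ᵇ-++⁺ˡ : ∀ p xs ys → (p ∈ᵇ xs) ≡ true → (p ∈ᵇ (xs ++ ys)) ≡ true
∈ᵇ-++⁺ˡ p xs ys p∈xs rewrite ∈ᵇ-++ p xs ys | p∈xs = refl

∈ᵇ-∷ʳ-last : ∀ p xs → (p ∈ᵇ (xs ++ [ p ])) ≡ true
∈ᵇ-∷ʳ-last p xs rewrite ∈ᵇ-∷ʳ p xs p | ==P-refl p = ∨-zeroʳ _

∈ᵇ-∷ʳ⁻ : ∀ p xs y → (p ∈ᵇ (xs ++ [ y ])) ≡ true → (p ==P y) ≡ false → (p ∈ᵇ xs) ≡ true
∈ᵇ-∷ʳ⁻ p xs y p∈ p≢y =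
  trans (sym (∨-identityʳ _)) (trans (cong ((p ∈ᵇ xs) ∨_) (sym p≢y)) (trans (sym (∈ᵇ-∷ʳ p xs y)) p∈))

∈ᵇ-self : ∀ xs → All (λ u → (u ∈ᵇ xs) ≡ true) xs
∈ᵇ-self []       = []
∈ᵇ-self (x ∷ xs) = cong (_∨ (x ∈ᵇ xs)) (==P-refl x)
                 ∷ All.map (λ {u} u∈xs → trans (cong ((u ==P x) ∨_) u∈xs) (∨-zeroʳ _)) (∈ᵇ-self xs)

∉ᵇ : ∀ p xs → All (p ≢_) xs → (p ∈ᵇ xs) ≡ false
∉ᵇ p []       []         = refl
∉ᵇ p (x ∷ xs) (p≢x ∷ ps) rewrite ≢⇒==P-false p x p≢x = ∉ᵇ p xs ps

_⊑_ : Path → Path → Set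
p ⊑ q = Σ Path λ x → q ≡ p ++ x

⊑-∷ʳ : ∀ w q e y ys → q ++ [ e ] ≡ w ++ (y ∷ ys) → w ⊑ q
⊑-∷ʳ []          q       e y ys eq = q , refl
⊑-∷ʳ (a ∷ [])    []      e y ys ()
⊑-∷ʳ (a ∷ _ ∷ _) []      e y ys ()
⊑-∷ʳ (a ∷ w) (b ∷ q) e y ys eq
  with refl ← cong (take 1) eq
  with x , refl ← ⊑-∷ʳ w q e y ys (cong (drop 1) eq) = x , refl

∷ʳ-≢ : ∀ (p : Path) d → p ++ [ d ] ≢ p
∷ʳ-≢ []      d ()
∷ʳ-≢ (_ ∷ p) d eq = ∷ʳ-≢ p d (cong (drop 1) eq)

¬⊑-∷ : ∀ d {p q} → ¬ (d ∷ p) ⊑ (d ∷ q) → ¬ p ⊑ q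
¬⊑-∷ d ¬⊑ (x , eq) = ¬⊑ (x , cong (d ∷_) eq)

before-++ˡ : ∀ p q x → ¬ p ⊑ q → ((p ++ x) before q) ≡ (p before q)
before-++ˡ []      q       x ¬⊑ = ⊥-elim (¬⊑ (q , refl))
before-++ˡ (L ∷ p) []      x ¬⊑ = refl
before-++ˡ (R ∷ p) []      x ¬⊑ = refl
before-++ˡ (L ∷ p) (L ∷ q) x ¬⊑ = before-++ˡ p q x (¬⊑-∷ L ¬⊑)
before-++ˡ (R ∷ p) (R ∷ q) x ¬⊑ = before-++ˡ p q x (¬⊑-∷ R ¬⊑)
before-++ˡ (L ∷ p) (R ∷ q) x ¬⊑ = refl
before-++ˡ (R ∷ p) (L ∷ q) x ¬⊑ = refl

before-++ʳ : ∀ p q x → ¬ p ⊑ q → (q before (p ++ x)) ≡ (q before p)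
before-++ʳ []      q       x ¬⊑ = ⊥-elim (¬⊑ (q , refl))
before-++ʳ (L ∷ p) []      x ¬⊑ = refl
before-++ʳ (R ∷ p) []      x ¬⊑ = refl
before-++ʳ (L ∷ p) (L ∷ q) x ¬⊑ = before-++ʳ p q x (¬⊑-∷ L ¬⊑)
before-++ʳ (R ∷ p) (R ∷ q) x ¬⊑ = before-++ʳ p q x (¬⊑-∷ R ¬⊑)
before-++ʳ (L ∷ p) (R ∷ q) x ¬⊑ = refl
before-++ʳ (R ∷ p) (L ∷ q) x ¬⊑ = refl

before-irrefl : ∀ p → (p before p) ≡ false
before-irrefl []      = refl
before-irrefl (L ∷ p) = before-irrefl p
before-irrefl (R ∷ p) = before-irrefl p

before-L : ∀ p → (p before (p ++ [ L ])) ≡ false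
before-L []      = refl
before-L (L ∷ p) = before-L p
before-L (R ∷ p) = before-L p

before-R : ∀ p → (p before (p ++ [ R ])) ≡ true
before-R []      = refl
before-R (L ∷ p) = before-R p
before-R (R ∷ p) = before-R p

before-L-R : ∀ p → ((p ++ [ L ]) before (p ++ [ R ])) ≡ true
before-L-R []      = refl
before-L-R (L ∷ p) = before-L-R p
before-L-R (R ∷ p) = before-L-R p

before-R-L : ∀ p → ((p ++ [ R ]) before (p ++ [ L ])) ≡ false
before-R-L []      = refl
before-R-L (L ∷ p) = before-R-L p
before-R-L (R ∷ p) = before-R-L p

-- Slots and nodes in symmetric order

data Slot (S : List Path) : Path → Set where
  slot : ∀ q d → (q ∈ᵇ S) ≡ true → ((q ++ [ d ]) ∈ᵇ S) ≡ false → Slot S (q ++ [ d ])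

data TreeSet : List Path → Set where
  root-only : TreeSet ([] ∷ [])
  add       : ∀ {S v} → TreeSet S → Slot S v → TreeSet (S ++ [ v ])

parent-closed : ∀ {S} → TreeSet S → ∀ q e → ((q ++ [ e ]) ∈ᵇ S) ≡ true → (q ∈ᵇ S) ≡ true
parent-closed root-only []      e ()
parent-closed root-only (_ ∷ _) e ()
parent-closed (add {S} g (slot p d p∈ _)) q e qe∈ rewrite ∈ᵇ-∷ʳ (q ++ [ e ]) S (p ++ [ d ])
  with (q ++ [ e ]) ∈ᵇ S in qe∈S
... | true = ∈ᵇ-++⁺ˡ q S _ (parent-closed g q e qe∈S)
... | false with refl ← ∷ʳ-injectiveˡ q p (==P⇒≡ _ _ qe∈) = ∈ᵇ-++⁺ˡ q S _ p∈

prefix-closed : ∀ {S} → TreeSet S → ∀ q x → ((q ++ x) ∈ᵇ S) ≡ true → (q ∈ᵇ S) ≡ true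
prefix-closed {S} g q []      qx∈ = subst (λ z → (z ∈ᵇ S) ≡ true) (++-identityʳ q) qx∈
prefix-closed {S} g q (e ∷ x) qx∈ =
  parent-closed g q e (prefix-closed g (q ++ [ e ]) x (subst (λ z → (z ∈ᵇ S) ≡ true) (sym (++-assoc q [ e ] x)) qx∈))

∉-extend : ∀ {S} → TreeSet S → ∀ v x → (v ∈ᵇ S) ≡ false → ((v ++ x) ∈ᵇ S) ≡ false
∉-extend {S} g v x v∉ with (v ++ x) ∈ᵇ S in vx∈
... | true  = ⊥-elim (true≢false (trans (sym (prefix-closed g v x vx∈)) v∉))
... | false = refl

∉⇒¬⊑∈ : ∀ {S} → TreeSet S → ∀ {v u} → (v ∈ᵇ S) ≡ false → (u ∈ᵇ S) ≡ true → ¬ v ⊑ u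
∉⇒¬⊑∈ g {v} v∉ u∈ (x , refl) with () ← trans (sym (prefix-closed g v x u∈)) v∉

¬⊑-freeChild : ∀ {S} → TreeSet S → ∀ {w u} e → (w ∈ᵇ S) ≡ false → (u ∈ᵇ S) ≡ true →
  ((u ++ [ e ]) ∈ᵇ (S ++ [ w ])) ≡ false → ¬ w ⊑ (u ++ [ e ])
¬⊑-freeChild {S} g {w} e w∉ u∈ ue∉ ([] , eq) rewrite ++-identityʳ w | eq
  with () ← trans (sym (∈ᵇ-∷ʳ-last w S)) ue∉
¬⊑-freeChild g {w} {u} e w∉ u∈ ue∉ (y ∷ ys , eq) = ∉⇒¬⊑∈ g w∉ u∈ (⊑-∷ʳ w u e y ys eq)

occurrences : Path → List Path → ℕ
occurrences p = count (_==P p)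

occurrences-∉ : ∀ p U → (p ∈ᵇ U) ≡ false → occurrences p U ≡ 0
occurrences-∉ p []      _ = refl
occurrences-∉ p (x ∷ U) p∉ with p ==P x in eq
occurrences-∉ p (x ∷ U) () | true
... | false rewrite ==P-sym x p | eq = occurrences-∉ p U p∉

occurrences-TreeSet : ∀ {S} → TreeSet S → ∀ p → (p ∈ᵇ S) ≡ true → occurrences p S ≡ 1
occurrences-TreeSet root-only []      _  = refl
occurrences-TreeSet root-only (_ ∷ _) ()
occurrences-TreeSet (add {S} {w} g (slot q d _ w∉)) p p∈
  rewrite count-++ (_==P p) S [ w ] | ∈ᵇ-∷ʳ p S w with p ∈ᵇ S in p∈S
... | true rewrite occurrences-TreeSet g p p∈S
                 | ≢⇒==P-false w p (λ { refl → true≢false (trans (sym p∈S) w∉) }) = refl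
... | false rewrite occurrences-∉ p S p∈S | ==P-sym w p | p∈ = refl

freeChildren : List Path → Path → List Path
freeChildren S u = filterᵇ (λ c → not (c ∈ᵇ S)) ((u ++ [ L ]) ∷ (u ++ [ R ]) ∷ [])

count-freeChildren : ∀ P S u → count P (freeChildren S u) ≡
  indicator (not ((u ++ [ L ]) ∈ᵇ S) ∧ P (u ++ [ L ])) + (indicator (not ((u ++ [ R ]) ∈ᵇ S) ∧ P (u ++ [ R ])) + 0)
count-freeChildren P S u = count-filterᵇ P (λ c → not (c ∈ᵇ S)) _

count-freeChildren-add : ∀ S p d → ((p ++ [ d ]) ∈ᵇ S) ≡ false → ∀ P u →
  count P (freeChildren S u) ≡
  count P (freeChildren (S ++ [ p ++ [ d ] ]) u) + (if u ==P p then indicator (P (p ++ [ d ])) else 0)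
count-freeChildren-add S p d pd∉ P u
  rewrite count-freeChildren P S u | count-freeChildren P (S ++ [ p ++ [ d ] ]) u
        | ∈ᵇ-∷ʳ (u ++ [ L ]) S (p ++ [ d ]) | ∈ᵇ-∷ʳ (u ++ [ R ]) S (p ++ [ d ])
  with u ==P p in u=p
... | false rewrite ∷ʳ-==P-false u p L d u=p | ∷ʳ-==P-false u p R d u=p
                  | ∨-identityʳ ((u ++ [ L ]) ∈ᵇ S) | ∨-identityʳ ((u ++ [ R ]) ∈ᵇ S)
  = sym (+-identityʳ _)
... | true with refl ← ==P⇒≡ u p u=p with d
...   | L rewrite pd∉ | ==P-refl (p ++ [ L ]) | ≢⇒==P-false (p ++ [ R ]) (p ++ [ L ]) (L≢R ∘ sym ∘ ∷ʳ-injectiveʳ p p)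
                | ∨-identityʳ ((p ++ [ R ]) ∈ᵇ S)
  = +-comm (indicator (P (p ++ [ L ]))) _
...   | R rewrite pd∉ | ==P-refl (p ++ [ R ]) | ≢⇒==P-false (p ++ [ L ]) (p ++ [ R ]) (L≢R ∘ ∷ʳ-injectiveʳ p p)
                | ∨-identityʳ ((p ++ [ L ]) ∈ᵇ S)
  = trans (cong (indicator (not ((p ++ [ L ]) ∈ᵇ S) ∧ P (p ++ [ L ])) +_) (+-identityʳ _))
          (cong (_+ indicator (P (p ++ [ R ]))) (sym (+-identityʳ _)))

count-concatMap-freeChildren-add : ∀ S p d → ((p ++ [ d ]) ∈ᵇ S) ≡ false → ∀ P U →
  count P (concatMap (freeChildren S) U) ≡
  count P (concatMap (freeChildren (S ++ [ p ++ [ d ] ])) U) + occurrences p U * indicator (P (p ++ [ d ]))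
count-concatMap-freeChildren-add S p d pd∉ P []      = refl
count-concatMap-freeChildren-add S p d pd∉ P (u ∷ U)
  rewrite count-++ P (freeChildren S u) (concatMap (freeChildren S) U)
        | count-++ P (freeChildren (S ++ [ p ++ [ d ] ]) u) (concatMap (freeChildren (S ++ [ p ++ [ d ] ])) U)
        | count-freeChildren-add S p d pd∉ P u | count-concatMap-freeChildren-add S p d pd∉ P U
  with u ==P p
... | true  = +-interchange (count P (freeChildren (S ++ [ p ++ [ d ] ]) u)) _ _ _
... | false = +-interchange (count P (freeChildren (S ++ [ p ++ [ d ] ]) u)) 0 _ _

count-before-extend : ∀ {S} → TreeSet S → ∀ w x → (w ∈ᵇ S) ≡ false →
  count (_before (w ++ x)) S ≡ count (_before w) S
count-before-extend {S} g w x w∉ =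
  count-cong (All.map (λ {u} u∈ → before-++ʳ w u x (∉⇒¬⊑∈ g w∉ u∈)) (∈ᵇ-self S))

freeChildren-before-extend : ∀ {S} → TreeSet S → ∀ w x → (w ∈ᵇ S) ≡ false → ∀ {u} → (u ∈ᵇ S) ≡ true →
  count (_before (w ++ x)) (freeChildren (S ++ [ w ]) u) ≡ count (_before w) (freeChildren (S ++ [ w ]) u)
freeChildren-before-extend {S} g w x w∉ {u} u∈ =
  begin
    count (_before (w ++ x)) (freeChildren (S ++ [ w ]) u)
  ≡⟨ count-freeChildren (_before (w ++ x)) (S ++ [ w ]) u ⟩
    child L (w ++ x) + (child R (w ++ x) + 0)
  ≡⟨ cong₂ (λ a b → a + (b + 0)) (child-before-extend L) (child-before-extend R) ⟩
    child L w + (child R w + 0)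
  ≡⟨ count-freeChildren (_before w) (S ++ [ w ]) u ⟨
    count (_before w) (freeChildren (S ++ [ w ]) u)
  ∎
  where
  open ≡-Reasoning
  child : Dir → Path → ℕ
  child e v = indicator (not ((u ++ [ e ]) ∈ᵇ (S ++ [ w ])) ∧ ((u ++ [ e ]) before v))
  child-before-extend : ∀ e → child e (w ++ x) ≡ child e w
  child-before-extend e with (u ++ [ e ]) ∈ᵇ (S ++ [ w ]) in ue∈
  ... | true  = refl
  ... | false = cong indicator (before-++ʳ w (u ++ [ e ]) x (¬⊑-freeChild g e w∉ u∈ ue∈))

count-before-extend-freeChildren : ∀ {S} → TreeSet S → ∀ w x → (w ∈ᵇ S) ≡ false → ∀ {U} →
  All (λ u → (u ∈ᵇ S) ≡ true) U →
  count (_before (w ++ x)) (concatMap (freeChildren (S ++ [ w ])) U) ≡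
  count (_before w) (concatMap (freeChildren (S ++ [ w ])) U)
count-before-extend-freeChildren g w x w∉ []                 = refl
count-before-extend-freeChildren {S} g w x w∉ {u ∷ U} (u∈ ∷ U∈) =
  begin
    count (_before (w ++ x)) (freeChildren S' u ++ concatMap (freeChildren S') U)
  ≡⟨ count-++ (_before (w ++ x)) (freeChildren S' u) _ ⟩
    count (_before (w ++ x)) (freeChildren S' u) + count (_before (w ++ x)) (concatMap (freeChildren S') U)
  ≡⟨ cong₂ _+_ (freeChildren-before-extend g w x w∉ u∈) (count-before-extend-freeChildren g w x w∉ U∈) ⟩
    count (_before w) (freeChildren S' u) + count (_before w) (concatMap (freeChildren S') U)
  ≡⟨ count-++ (_before w) (freeChildren S' u) _ ⟨
    count (_before w) (freeChildren S' u ++ concatMap (freeChildren S') U)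
  ∎
  where
  open ≡-Reasoning
  S' = S ++ [ w ]

count-slots-after-add : ∀ {S} → TreeSet S → ∀ {w} → (w ∈ᵇ S) ≡ false → ∀ P →
  count P (slots (S ++ [ w ])) ≡
  count P (concatMap (freeChildren (S ++ [ w ])) S) + (indicator (P (w ++ [ L ])) + indicator (P (w ++ [ R ])))
count-slots-after-add {S} g {w} w∉ P
  rewrite concatMap-++ (freeChildren (S ++ [ w ])) S [ w ]
        | count-++ P (concatMap (freeChildren (S ++ [ w ])) S) (freeChildren (S ++ [ w ]) w ++ [])
        | ++-identityʳ (freeChildren (S ++ [ w ]) w)
        | count-freeChildren P (S ++ [ w ]) w
        | ∈ᵇ-∷ʳ (w ++ [ L ]) S w | ∈ᵇ-∷ʳ (w ++ [ R ]) S w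
        | ∉-extend g w [ L ] w∉ | ∉-extend g w [ R ] w∉
        | ≢⇒==P-false _ _ (∷ʳ-≢ w L) | ≢⇒==P-false _ _ (∷ʳ-≢ w R)
        | +-identityʳ (indicator (P (w ++ [ R ]))) = refl

count-slots-before-add : ∀ {S w} → TreeSet S → Slot S w → ∀ P →
  count P (slots S) ≡ count P (concatMap (freeChildren (S ++ [ w ])) S) + indicator (P w)
count-slots-before-add {S} g (slot q d q∈ w∉) P =
  trans (count-concatMap-freeChildren-add S q d w∉ P S)
        (cong (count P (concatMap (freeChildren (S ++ [ q ++ [ d ] ])) S) +_)
              (trans (cong (_* indicator (P (q ++ [ d ]))) (occurrences-TreeSet g q q∈)) (*-identityˡ _)))

Slot-∉ : ∀ {S w} → Slot S w → (w ∈ᵇ S) ≡ false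
Slot-∉ (slot _ _ _ w∉) = w∉

slots-before≡nodes-before-nonchild : ∀ {S w v} → TreeSet S → Slot S w → ¬ w ⊑ v →
  count (_before v) (slots S) ≡ count (_before v) S →
  count (_before v) (slots (S ++ [ w ])) ≡ count (_before v) (S ++ [ w ])
slots-before≡nodes-before-nonchild {S} {w} {v} g sl ¬w⊑v ih =
  begin
    count P (slots (S ++ [ w ]))
  ≡⟨ count-slots-after-add g (Slot-∉ sl) P ⟩
    c + (indicator (P (w ++ [ L ])) + indicator (P (w ++ [ R ])))
  ≡⟨ cong₂ (λ x y → c + (indicator x + indicator y)) (before-++ˡ w v [ L ] ¬w⊑v) (before-++ˡ w v [ R ] ¬w⊑v) ⟩
    c + (b + b)
  ≡⟨ +-assoc c b b ⟨
    c + b + b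
  ≡⟨ cong (_+ b) (trans (sym (count-slots-before-add g sl P)) ih) ⟩
    count P S + b
  ≡⟨ cong (count P S +_) (+-identityʳ b) ⟨
    count P S + count P [ w ]
  ≡⟨ count-++ P S [ w ] ⟨
    count P (S ++ [ w ])
  ∎
  where
  open ≡-Reasoning
  P = _before v
  c = count P (concatMap (freeChildren (S ++ [ w ])) S)
  b = indicator (P w)

children-before-child : ∀ w e →
  indicator ((w ++ [ L ]) before (w ++ [ e ])) + indicator ((w ++ [ R ]) before (w ++ [ e ])) ≡
  indicator (w before (w ++ [ e ])) + 0
children-before-child w L rewrite before-irrefl (w ++ [ L ]) | before-R-L w | before-L w = refl
children-before-child w R rewrite before-L-R w | before-irrefl (w ++ [ R ]) | before-R w = refl

slots-before≡nodes-before-child : ∀ {S w} e → TreeSet S → Slot S w →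
  count (_before w) (slots S) ≡ count (_before w) S →
  count (_before (w ++ [ e ])) (slots (S ++ [ w ])) ≡ count (_before (w ++ [ e ])) (S ++ [ w ])
slots-before≡nodes-before-child {S} {w} e g sl ih =
  begin
    count P (slots (S ++ [ w ]))
  ≡⟨ count-slots-after-add g w∉ P ⟩
    count P C + children
  ≡⟨ cong (_+ children) (count-before-extend-freeChildren g w [ e ] w∉ (∈ᵇ-self S)) ⟩
    count (_before w) C + children
  ≡⟨ cong (_+ children) C-before-w ⟩
    count (_before w) S + children
  ≡⟨ cong₂ _+_ (count-before-extend g w [ e ] w∉) (sym (children-before-child w e)) ⟨
    count P S + count P [ w ]
  ≡⟨ count-++ P S [ w ] ⟨
    count P (S ++ [ w ])
  ∎
  where
  open ≡-Reasoning
  P = _before (w ++ [ e ])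
  C = concatMap (freeChildren (S ++ [ w ])) S
  children = indicator (P (w ++ [ L ])) + indicator (P (w ++ [ R ]))
  w∉ = Slot-∉ sl
  C-before-w : count (_before w) C ≡ count (_before w) S
  C-before-w = begin
      count (_before w) C                           ≡⟨ +-identityʳ _ ⟨
      count (_before w) C + 0                       ≡⟨ cong (λ b → count (_before w) C + indicator b) (before-irrefl w) ⟨
      count (_before w) C + indicator (w before w)  ≡⟨ count-slots-before-add g sl (_before w) ⟨
      count (_before w) (slots S)                   ≡⟨ ih ⟩
      count (_before w) S                           ∎

slots-before≡nodes-before : ∀ {S v} → TreeSet S → Slot S v → count (_before v) (slots S) ≡ count (_before v) S
slots-before≡nodes-before root-only (slot [] L _ _) = refl
slots-before≡nodes-before root-only (slot [] R _ _) = refl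
slots-before≡nodes-before root-only (slot (_ ∷ _) _ () _)
slots-before≡nodes-before (add {S} {w} g sl) (slot p e p∈ v∉) with p ==P w in p=w
... | true with refl ← ==P⇒≡ p w p=w = slots-before≡nodes-before-child e g sl (slots-before≡nodes-before g sl)
... | false = slots-before≡nodes-before-nonchild g sl (¬⊑-freeChild g e (Slot-∉ sl) p∈S v∉)
                                          (slots-before≡nodes-before g (slot p e p∈S v∉S))
  where
  p∈S = ∈ᵇ-∷ʳ⁻ p S w p∈ p=w
  v∉S = ∨-conicalˡ _ _ (trans (sym (∈ᵇ-∷ʳ (p ++ [ e ]) S w)) v∉)

-- Processing a subtree in preorder

nodes : Path → STree → List Path
nodes p t = map proj₁ (pre p t)

nodes-node : ∀ p s l r → nodes p (node s l r) ≡ p ∷ (nodes (p ++ [ L ]) l ++ nodes (p ++ [ R ]) r)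
nodes-node p s l r = cong (p ∷_) (map-++ proj₁ (pre (p ++ [ L ]) l) (pre (p ++ [ R ]) r))

length-nodes : ∀ p t → length (nodes p t) ≡ size t
length-nodes p leaf         = refl
length-nodes p (node s l r) = trans (cong length (nodes-node p s l r)) (cong suc (
  trans (length-++ (nodes (p ++ [ L ]) l)) (cong₂ _+_ (length-nodes (p ++ [ L ]) l) (length-nodes (p ++ [ R ]) r))))

⊑-nodes : ∀ p t → All (p ⊑_) (nodes p t)
⊑-nodes p leaf         = []
⊑-nodes p (node s l r) rewrite nodes-node p s l r =
  ([] , sym (++-identityʳ p))
    ∷ All.++⁺ (All.map (⊑-∷ʳ⁻ L) (⊑-nodes (p ++ [ L ]) l)) (All.map (⊑-∷ʳ⁻ R) (⊑-nodes (p ++ [ R ]) r))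
  where
  ⊑-∷ʳ⁻ : ∀ d {u} → (p ++ [ d ]) ⊑ u → p ⊑ u
  ⊑-∷ʳ⁻ d (x , refl) = d ∷ x , ++-assoc p [ d ] x

¬L⊑R : ∀ p → ¬ (p ++ [ L ]) ⊑ (p ++ [ R ])
¬L⊑R p (x , eq) with () ← ++-cancelˡ p [ R ] (L ∷ x) (trans eq (++-assoc p [ L ] x))

count-before-R-nodes-L : ∀ p l → count (_before (p ++ [ R ])) (nodes (p ++ [ L ]) l) ≡ size l
count-before-R-nodes-L p l =
  trans (count-all (All.map (λ { (x , refl) → trans (before-++ˡ (p ++ [ L ]) (p ++ [ R ]) x (¬L⊑R p)) (before-L-R p) })
                            (⊑-nodes (p ++ [ L ]) l)))
        (length-nodes (p ++ [ L ]) l)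

process-++ : ∀ S xs ys σ → process S (xs ++ ys) σ ≡ process (S ++ map proj₁ xs) ys (process S xs σ)
process-++ S []             ys σ rewrite ++-identityʳ S = refl
process-++ S ((v , s) ∷ xs) ys σ
  rewrite process-++ (S ++ [ v ]) xs ys (insert s (relPos S v) σ) | ++-assoc S [ v ] (map proj₁ xs) = refl

relPos-count : ∀ {S v} → TreeSet S → Slot S v → relPos S v ≡ suc (count (_before v) S)
relPos-count {S} {v} g sl = cong suc (trans (length-filterᵇ (_before v) (slots S)) (slots-before≡nodes-before g sl))

relPos≤ : ∀ {S v} → TreeSet S → Slot S v → relPos S v ≤ suc (length S)
relPos≤ {S} {v} g sl = subst (_≤ suc (length S)) (sym (relPos-count g sl)) (s≤s (count≤length (_before v) S))

child-∉-∷ʳ : ∀ {S} → TreeSet S → ∀ {p} → (p ∈ᵇ S) ≡ false → ∀ e → ((p ++ [ e ]) ∈ᵇ (S ++ [ p ])) ≡ false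
child-∉-∷ʳ {S} g {p} p∉ e
  rewrite ∈ᵇ-∷ʳ (p ++ [ e ]) S p | ∉-extend g p [ e ] p∉ | ≢⇒==P-false _ _ (∷ʳ-≢ p e) = refl

slot-L : ∀ {S p} → TreeSet S → Slot S p → Slot (S ++ [ p ]) (p ++ [ L ])
slot-L {S} {p} g sl = slot p L (∈ᵇ-∷ʳ-last p S) (child-∉-∷ʳ g (Slot-∉ sl) L)

slot-R-after : ∀ {S p} l → (p ∈ᵇ S) ≡ true → ((p ++ [ R ]) ∈ᵇ S) ≡ false →
  Slot (S ++ nodes (p ++ [ L ]) l) (p ++ [ R ])
slot-R-after {S} {p} l p∈ pR∉ = slot p R (∈ᵇ-++⁺ˡ p S _ p∈) (trans (∈ᵇ-++ (p ++ [ R ]) S _) (cong₂ _∨_ pR∉ pR∉nodes))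
  where
  pR∉nodes : ((p ++ [ R ]) ∈ᵇ nodes (p ++ [ L ]) l) ≡ false
  pR∉nodes = ∉ᵇ _ _ (All.map (λ { u⊑ refl → ¬L⊑R p u⊑ }) (⊑-nodes (p ++ [ L ]) l))

slot-R : ∀ {S p} l → TreeSet S → Slot S p → Slot ((S ++ [ p ]) ++ nodes (p ++ [ L ]) l) (p ++ [ R ])
slot-R {S} {p} l g sl = slot-R-after l (∈ᵇ-∷ʳ-last p S) (child-∉-∷ʳ g (Slot-∉ sl) R)

treeSet-++-nodes : ∀ t {S p} → TreeSet S → Slot S p → TreeSet (S ++ nodes p t)
treeSet-++-nodes leaf         {S}     g _  = subst TreeSet (sym (++-identityʳ S)) g
treeSet-++-nodes (node s l r) {S} {p} g sl = subst TreeSet S₂++r≡ (treeSet-++-nodes r g₂ (slot-R l g sl))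
  where
  g₂ = treeSet-++-nodes l (add g sl) (slot-L g sl)
  S₂++r≡ : ((S ++ [ p ]) ++ nodes (p ++ [ L ]) l) ++ nodes (p ++ [ R ]) r ≡ S ++ nodes p (node s l r)
  S₂++r≡ = trans (++-assoc (S ++ [ p ]) _ _)
                 (trans (++-assoc S [ p ] _) (cong (S ++_) (sym (nodes-node p s l r))))

relPos-L : ∀ {S p} → TreeSet S → Slot S p → relPos (S ++ [ p ]) (p ++ [ L ]) ≡ relPos S p
relPos-L {S} {p} g sl = begin
    relPos (S ++ [ p ]) (p ++ [ L ])
  ≡⟨ relPos-count (add g sl) (slot-L g sl) ⟩
    suc (count (_before (p ++ [ L ])) (S ++ [ p ]))
  ≡⟨ cong suc (count-++ (_before (p ++ [ L ])) S [ p ]) ⟩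
    suc (count (_before (p ++ [ L ])) S + (indicator (p before (p ++ [ L ])) + 0))
  ≡⟨ cong₂ (λ c b → suc (c + (indicator b + 0))) (count-before-extend g p [ L ] (Slot-∉ sl)) (before-L p) ⟩
    suc (count (_before p) S + 0)
  ≡⟨ cong suc (+-identityʳ _) ⟩
    suc (count (_before p) S)
  ≡⟨ relPos-count g sl ⟨
    relPos S p
  ∎
  where open ≡-Reasoning

relPos-R-after : ∀ {S p} l → TreeSet (S ++ nodes (p ++ [ L ]) l) → Slot (S ++ nodes (p ++ [ L ]) l) (p ++ [ R ]) →
  relPos (S ++ nodes (p ++ [ L ]) l) (p ++ [ R ]) ≡ suc (count (_before (p ++ [ R ])) S + size l)
relPos-R-after {S} {p} l g sl =
  trans (relPos-count g sl)
        (cong suc (trans (count-++ (_before (p ++ [ R ])) S (nodes (p ++ [ L ]) l))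
                         (cong (count (_before (p ++ [ R ])) S +_) (count-before-R-nodes-L p l))))

relPos-R : ∀ {S p} l → TreeSet S → Slot S p →
  relPos ((S ++ [ p ]) ++ nodes (p ++ [ L ]) l) (p ++ [ R ]) ≡ suc (relPos S p + size l)
relPos-R {S} {p} l g sl = begin
    relPos ((S ++ [ p ]) ++ nodes (p ++ [ L ]) l) (p ++ [ R ])
  ≡⟨ relPos-R-after l (treeSet-++-nodes l (add g sl) (slot-L g sl)) (slot-R l g sl) ⟩
    suc (count (_before (p ++ [ R ])) (S ++ [ p ]) + size l)
  ≡⟨ cong (λ c → suc (c + size l)) (count-++ (_before (p ++ [ R ])) S [ p ]) ⟩
    suc (count (_before (p ++ [ R ])) S + (indicator (p before (p ++ [ R ])) + 0) + size l)
  ≡⟨ cong₂ (λ c b → suc (c + (indicator b + 0) + size l)) (count-before-extend g p [ R ] (Slot-∉ sl)) (before-R p) ⟩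
    suc (count (_before p) S + 1 + size l)
  ≡⟨ cong (λ c → suc (c + size l)) (+-comm (count (_before p) S) 1) ⟩
    suc (suc (count (_before p) S) + size l)
  ≡⟨ cong (λ c → suc (c + size l)) (relPos-count g sl) ⟨
    suc (relPos S p + size l)
  ∎
  where open ≡-Reasoning

process-pre : ∀ t {S p} σ N → N ≡ suc (length S) → TreeSet S → Slot S p →
  process S (pre p t) (map σ (iterate suc 1 N)) ≡ map (expand (relPos S p) t σ) (iterate suc 1 (N + size t))
process-pre leaf σ N _ _ _ rewrite +-identityʳ N = refl
process-pre (node s l r) {S} {p} σ N N≡ g sl = begin
    process S₁ (pre pL l ++ pre pR r) (insert s i (map σ (iterate suc 1 N)))
  ≡⟨ cong (process S₁ (pre pL l ++ pre pR r)) (insert≡signedInsert s i σ N (s≤s z≤n) i≤N) ⟩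
    process S₁ (pre pL l ++ pre pR r) (map τ (iterate suc 1 (suc N)))
  ≡⟨ process-++ S₁ (pre pL l) (pre pR r) _ ⟩
    process S₂ (pre pR r) (process S₁ (pre pL l) (map τ (iterate suc 1 (suc N))))
  ≡⟨ cong (process S₂ (pre pR r)) (process-pre l τ (suc N) N₁≡ (add g sl) (slot-L g sl)) ⟩
    process S₂ (pre pR r) (map (expand (relPos S₁ pL) l τ) (iterate suc 1 (suc N + size l)))
  ≡⟨ cong (λ j → process S₂ (pre pR r) (map (expand j l τ) (iterate suc 1 (suc N + size l)))) (relPos-L g sl) ⟩
    process S₂ (pre pR r) (map ρ (iterate suc 1 (suc N + size l)))
  ≡⟨ process-pre r ρ (suc N + size l) N₂≡ (treeSet-++-nodes l (add g sl) (slot-L g sl)) (slot-R l g sl) ⟩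
    map (expand (relPos S₂ pR) r ρ) (iterate suc 1 (suc N + size l + size r))
  ≡⟨ cong₂ (λ j n → map (expand j r ρ) (iterate suc 1 n)) (relPos-R l g sl) size≡ ⟩
    map (expand i (node s l r) σ) (iterate suc 1 (N + size (node s l r)))
  ∎
  where
  open ≡-Reasoning
  pL = p ++ [ L ]
  pR = p ++ [ R ]
  S₁ = S ++ [ p ]
  S₂ = S₁ ++ nodes pL l
  i = relPos S p
  τ = signedInsert s i σ
  ρ = expand i l τ
  i≤N : i ≤ N
  i≤N = subst (i ≤_) (sym N≡) (relPos≤ g sl)
  N₁≡ : suc N ≡ suc (length S₁)
  N₁≡ = cong suc (trans N≡ (trans (+-comm 1 (length S)) (sym (length-++ S))))
  N₂≡ : suc N + size l ≡ suc (length S₂)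
  N₂≡ = trans (cong (_+ size l) N₁≡) (cong suc (sym (trans (length-++ S₁) (cong (length S₁ +_) (length-nodes pL l)))))
  size≡ : suc N + size l + size r ≡ N + size (node s l r)
  size≡ = trans (+-assoc (suc N) (size l) (size r)) (sym (+-suc N _))

cycleOf≡ : ∀ T → cycleOf T ≡ map (cycleFun T) (iterate suc 1 (suc (suc (rsize T))))
cycleOf≡ (root A C) = begin
    process ([] ∷ []) (pre [ L ] A ++ pre [ R ] C) (map σ₀ (iterate suc 1 2))
  ≡⟨ process-++ ([] ∷ []) (pre [ L ] A) (pre [ R ] C) _ ⟩
    process S₁ (pre [ R ] C) (process ([] ∷ []) (pre [ L ] A) (map σ₀ (iterate suc 1 2)))
  ≡⟨ cong (process S₁ (pre [ R ] C)) (process-pre A σ₀ 2 refl root-only slot-L₀) ⟩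
    process S₁ (pre [ R ] C) (map (expand 1 A σ₀) (iterate suc 1 (2 + size A)))
  ≡⟨ process-pre C (expand 1 A σ₀) (2 + size A) (cong (2 +_) (sym (length-nodes [ L ] A))) g₁ slot-R₀ ⟩
    map (expand (relPos S₁ [ R ]) C (expand 1 A σ₀)) (iterate suc 1 (2 + size A + size C))
  ≡⟨ cong (λ j → map (expand j C (expand 1 A σ₀)) (iterate suc 1 (2 + size A + size C)))
          (relPos-R-after {[] ∷ []} {[]} A g₁ slot-R₀) ⟩
    map (cycleFun (root A C)) (iterate suc 1 (suc (suc (rsize (root A C)))))
  ∎
  where
  open ≡-Reasoning
  S₁ = ([] ∷ []) ++ nodes [ L ] A
  slot-L₀ : Slot ([] ∷ []) [ L ]
  slot-L₀ = slot [] L refl refl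
  slot-R₀ : Slot S₁ [ R ]
  slot-R₀ = slot-R-after {[] ∷ []} {[]} A refl refl
  g₁ = treeSet-++-nodes A root-only slot-L₀

cycleOf-rot : ∀ {T T'} → Rot T T' → cycleOf T ≡ cycleOf T'
cycleOf-rot {T} {T'} r = begin
    cycleOf T
  ≡⟨ cycleOf≡ T ⟩
    map (cycleFun T) (iterate suc 1 (suc (suc (rsize T))))
  ≡⟨ cong (λ n → map (cycleFun T) (iterate suc 1 (suc (suc n)))) (rsize-rot r) ⟩
    map (cycleFun T) (iterate suc 1 (suc (suc (rsize T'))))
  ≡⟨ map-cong (cycleFun-rot r) _ ⟩
    map (cycleFun T') (iterate suc 1 (suc (suc (rsize T'))))
  ≡⟨ cycleOf≡ T' ⟨
    cycleOf T'
  ∎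
  where open ≡-Reasoning

mainTheorem8 : (T T' : RTree) → RotRelated T T' → cycleOf T ≡ cycleOf T'
mainTheorem8 T .T ε        = refl
mainTheorem8 T T' (r ◅ rs) = trans (cycleOf-rot r) (mainTheorem8 _ T' rs)
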